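{- Let $\mathcal{I}=(V,d,k,z)$ be a $2$-metric outlier perturbation resilient instance of $k$-Center with outliers, with optimal clusters $\mathcal{C}=\{C_1,\dots,C_k\}$, optimal outliers $Z$, and optimal cost $r^*_d$. Let $p\in V\setminus Z$ with $p\in C_i$. Then for every $q\notin C_i$ (including outliers $q\in Z$), $d(p,q)>r^*_d$.
   Context: An instance $(V,d,k,z)$ of $k$-Center with outliers consists of a finite set $V$, a metric $d$ on $V$, and integers $k,z$. A solution chooses outliers $Z\subseteq V$ with $|Z|\le z$, centers $S=\{c_1,\dots,c_k\}\subseteq V\setminus Z$, and the Voronoi partition $\{C_1,\dots,C_k\}$ of $V\setminus Z$ induced by $S$; its cost is $\max_i\max_{u\in C_i}d(c_i,u)$, and $r^*_d$ is the optimal cost. The instance is $2$-metric outlier perturbation resilient if for every metric $d'$ with $d(u,v)/2\le d'(u,v)\le d(u,v)$ for all $u,v$, the unique optimal clustering and outliers of $(V,d',k,z)$ are identical to the optimal clustering and outliers of $(V,d,k,z)$.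
   Formalization: The metric d takes rational values rather than real ones, and the metrics $d'$ ranged over by 2-metric outlier perturbation resilience are likewise taken rational-valued. -}

module Defs where

open import Data.Nat using (ℕ)
open import Data.Fin using (Fin)
open import Data.Fin.Subset using (Subset; Side; inside; outside; _∈_; _∉_; ∣_∣)
open import Data.Vec using (lookup)
open import Data.List using (List; foldr; map; allFin)
open import Data.Rational using (ℚ; 0ℚ; ½; _*_; _+_; _≤_; _<_; _⊔_)
open import Data.Product using (Σ; _×_; _,_)
open import Function.Definitions using (Injective)
open import Function.Bundles using (_⇔_)
open import Relation.Binary.PropositionalEquality using (_≡_; _≢_)
open import Relation.Nullary using (¬_)

Dist : ℕ → Set
Dist n = Fin n → Fin n → ℚ

record IsMetric {n : ℕ} (d : Dist n) : Set where
  field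
    nonneg   : ∀ u v → 0ℚ ≤ d u v
    zero-iff : ∀ u v → d u v ≡ 0ℚ → u ≡ v
    refl0    : ∀ u → d u u ≡ 0ℚ
    symm     : ∀ u v → d u v ≡ d v u
    triangle : ∀ u v w → d u w ≤ d u v + d v w

-- A solution of the k-Center with outliers instance (V = Fin n, d, k, z):
-- outliers Z with |Z| ≤ z, k distinct centers outside Z, and an assignment
-- of every non-outlier to one of the centers that is nearest to it
-- (i.e. a Voronoi partition of V \ Z induced by the centers; ties may be
-- broken arbitrarily).
record Solution {n : ℕ} (d : Dist n) (k z : ℕ) : Set where
  field
    outliers  : Subset n
    center    : Fin k → Fin n
    assign    : Fin n → Fin k
    budget    : ∣ outliers ∣ Data.Nat.≤ z
    distinct  : Injective _≡_ _≡_ center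
    centerOk  : ∀ i → center i ∉ outliers
    voronoi   : ∀ u → u ∉ outliers → ∀ j → d (center (assign u)) u ≤ d (center j) u

open Solution public

private
  contrib : Side → ℚ → ℚ
  contrib inside  _ = 0ℚ
  contrib outside r = r

-- Cost of a solution: max over non-outliers u of d(center of u's cluster, u)
-- (0 if there are no non-outliers; all distances are ≥ 0).
cost : {n : ℕ} (d : Dist n) {k z : ℕ} → Solution d k z → ℚ
cost {n} d s =
  foldr _⊔_ 0ℚ
    (map (λ u → contrib (lookup (outliers s) u) (d (center s (assign s u)) u))
         (allFin n))

Optimal : {n : ℕ} (d : Dist n) (k z : ℕ) → Solution d k z → Set
Optimal d k z s = ∀ (s' : Solution d k z) → cost d s ≤ cost d s'

SameClusteringAndOutliers : {n : ℕ} {d d' : Dist n} {k z : ℕ} →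
  Solution d k z → Solution d' k z → Set
SameClusteringAndOutliers {n} s s' =
  (outliers s ≡ outliers s') ×
  (∀ (u v : Fin n) → u ∉ outliers s → v ∉ outliers s →
     (assign s u ≡ assign s v) ⇔ (assign s' u ≡ assign s' v))

IsPerturbation2 : {n : ℕ} → Dist n → Dist n → Set
IsPerturbation2 d d' = ∀ u v → (½ * d u v ≤ d' u v) × (d' u v ≤ d u v)

-- 2-metric outlier perturbation resilience: for every metric 2-perturbation
-- d' of d, every optimal solution of (V,d',k,z) has the same clustering and
-- outliers as every optimal solution of (V,d,k,z).  (Taking d' = d this
-- includes uniqueness of the optimal clustering/outliers of d.)
PerturbationResilient2 : {n : ℕ} (d : Dist n) (k z : ℕ) → Set
PerturbationResilient2 {n} d k z =
  ∀ (d' : Dist n) → IsMetric d' → IsPerturbation2 d d' →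
  ∀ (s : Solution d k z) → Optimal d k z s →
  ∀ (s' : Solution d' k z) → Optimal d' k z s' →
  SameClusteringAndOutliers s s'

module Submission where

open import Defs
open import Data.Nat using (ℕ)
import Data.Nat as ℕ
import Data.Nat.Properties as ℕ
open import Data.Fin using (Fin)
open import Data.Fin.Properties using (_≟_; any?)
open import Data.Fin.Subset using (Subset; inside; outside; _∈_; _∉_; _-_; ∣_∣)
open import Data.Fin.Subset.Properties using (_∈?_; ∣p─q∣≤∣p∣; p─q⊆p; x∈p∧x≢y⇒x∈p-y; x∈p⇒∣p-x∣<∣p∣)
open import Data.Vec using (lookup)
open import Data.Vec.Properties using ([]=⇒lookup; lookup⇒[]=)
open import Data.Vec.Functional using (updateAt)
open import Data.Vec.Functional.Properties using (updateAt-updates; updateAt-minimal)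
open import Data.List using (List; []; _∷_; foldr; map; allFin; filter; cartesianProduct)
open import Data.List.Membership.Propositional using () renaming (_∈_ to _∈ₗ_)
open import Data.List.Membership.Propositional.Properties using (∈-allFin; ∈-filter⁺; ∈-cartesianProduct⁺)
open import Data.List.Relation.Unary.Any using (here; there)
import Data.List.Relation.Unary.All as All
open import Data.List.Relation.Unary.All.Properties using (all-filter)
open import Data.Rational using (ℚ; 0ℚ; ½; _+_; _*_; _≤_; _<_; _⊔_; _⊓_)
open import Data.Rational.Properties hiding (_≟_)
open import Relation.Binary.Bundles using (DecTotalOrder)
open import Data.List.Extrema (DecTotalOrder.totalOrder ≤-decTotalOrder)
  using (argmin; f[argmin]≤f[xs]; f[argmin]≤f[⊤]; argmin-all)
open import Data.Product using (Σ; _×_; _,_; proj₁; proj₂)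
open import Data.Sum using (_⊎_; inj₁; inj₂)
open import Data.Empty using (⊥; ⊥-elim)
open import Function using (_∘_; const)
open import Function.Bundles using (Equivalence)
open import Function.Definitions using (Injective)
open import Relation.Binary.PropositionalEquality
  using (_≡_; _≢_; refl; sym; trans; cong; cong₂; subst)
open import Relation.Nullary using (yes; no)
open import Relation.Nullary.Decidable using (¬?; _×-dec_)
open import Relation.Unary using (Decidable)

-- Let r be the optimal cost of the resilient instance and suppose some point
-- p of a cluster C_i had a point q outside C_i (another cluster or an
-- outlier) with d(p,q) ≤ r.  We perturb d into D(u,v) = min(d, max(r, d/2)):
-- D is a metric 2-perturbation of d which keeps every distance ≤ r and
-- shrinks every distance ≤ 2r to at most r.  No D-solution costs less than r
-- (otherwise its distances would be unshrunk d-distances, beating the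
-- optimum), so every D-solution of cost ≤ r is D-optimal and, by resilience,
-- must have the clustering and outliers of the optimum.  We then exhibit such
-- a D-solution with different clusters or outliers:
--   * q an outlier: keep the centres and serve q from p's centre;
--   * q in another cluster: pass to a closest pair (p,q) of points in
--     different clusters, make p the centre of C_i, a suitable point w the
--     centre of q's cluster, and assign q to p.
-- The file first develops maxima of lists and the cost of a solution,
-- solutions built from a choice of centres, the perturbation, and the
-- resulting optimality criterion; the two cases then give the theorem.

maxOf : {A : Set} → (A → ℚ) → List A → ℚ
maxOf F xs = foldr _⊔_ 0ℚ (map F xs)

maxOf-nonneg : {A : Set} (F : A → ℚ) (xs : List A) → 0ℚ ≤ maxOf F xs
maxOf-nonneg F []       = ≤-refl
maxOf-nonneg F (x ∷ xs) = ≤-trans (maxOf-nonneg F xs) (p≤q⊔p (F x) _)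

maxOf-ub : {A : Set} (F : A → ℚ) {xs : List A} {x : A} → x ∈ₗ xs → F x ≤ maxOf F xs
maxOf-ub F {y ∷ ys} (here refl) = p≤p⊔q (F y) _
maxOf-ub F {y ∷ ys} (there x∈) = ≤-trans (maxOf-ub F x∈) (p≤q⊔p (F y) _)

maxOf-lub : {A : Set} (F : A → ℚ) (xs : List A) {R : ℚ} → 0ℚ ≤ R →
            (∀ x → F x ≤ R) → maxOf F xs ≤ R
maxOf-lub F []       0≤R F≤R = 0≤R
maxOf-lub F (x ∷ xs) 0≤R F≤R = ⊔-lub (F≤R x) (maxOf-lub F xs 0≤R F≤R)

-- `cost d s` is definitionally `maxOf` of a per-point summand that Defs keeps
-- private; `summandOf` recovers that function from the equation by unification.
summandOf : {n : ℕ} {F : Fin n → ℚ} (C : ℚ) → C ≡ maxOf F (allFin n) → Fin n → ℚ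
summandOf {F = F} _ _ = F

costSummand : {n k z : ℕ} (d : Dist n) (s : Solution d k z) → Fin n → ℚ
costSummand d s = summandOf (cost d s) refl

module _ {n k z : ℕ} (d : Dist n) (s : Solution d k z) where

  summand-outlier : ∀ u → u ∈ outliers s → costSummand d s u ≡ 0ℚ
  summand-outlier u u∈Z rewrite []=⇒lookup u∈Z = refl

  summand-point : ∀ u → u ∉ outliers s → costSummand d s u ≡ d (center s (assign s u)) u
  summand-point u u∉Z with lookup (outliers s) u in eq
  ... | inside  = ⊥-elim (u∉Z (lookup⇒[]= u (outliers s) eq))
  ... | outside = refl

  cost-nonneg : 0ℚ ≤ cost d s
  cost-nonneg = maxOf-nonneg (costSummand d s) (allFin n)

  assigned≤cost : ∀ u → u ∉ outliers s → d (center s (assign s u)) u ≤ cost d s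
  assigned≤cost u u∉Z = ≤-trans (≤-reflexive (sym (summand-point u u∉Z)))
                                (maxOf-ub (costSummand d s) (∈-allFin u))

  cost≤ : ∀ {R} → 0ℚ ≤ R → (∀ u → u ∉ outliers s → d (center s (assign s u)) u ≤ R) →
          cost d s ≤ R
  cost≤ {R} 0≤R bound = maxOf-lub (costSummand d s) (allFin n) 0≤R summand≤
    where
    summand≤ : ∀ u → costSummand d s u ≤ R
    summand≤ u with u ∈? outliers s
    ... | yes u∈Z = ≤-trans (≤-reflexive (summand-outlier u u∈Z)) 0≤R
    ... | no  u∉Z = ≤-trans (≤-reflexive (summand-point u u∉Z)) (bound u u∉Z)

own-centre : {n k z : ℕ} {e : Dist n} → IsMetric e → (S : Solution e k z) →
             ∀ l → assign S (center S l) ≡ l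
own-centre {e = e} em S l = distinct S (zero-iff _ _ distance≡0)
  where
  open IsMetric em
  distance≡0 : e (center S (assign S (center S l))) (center S l) ≡ 0ℚ
  distance≡0 = ≤-antisym
    (≤-trans (voronoi S (center S l) (centerOk S l) l) (≤-reflexive (refl0 (center S l))))
    (nonneg _ _)

NearestCentre : {n k : ℕ} → Dist n → (Fin k → Fin n) → Fin n → Set
NearestCentre {k = k} e c u = Σ (Fin k) λ m → ∀ l → e (c m) u ≤ e (c l) u

-- Nearest centres exist as soon as there is at least one centre.
nearestCentre : {n k : ℕ} (e : Dist n) (c : Fin k → Fin n) → Fin k → (u : Fin n) →
                NearestCentre e c u
nearestCentre {k = k} e c a u =
  argmin distance a (allFin k) ,
  λ l → All.lookup (f[argmin]≤f[xs] a (allFin k)) (∈-allFin l)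
  where
  distance : Fin k → ℚ
  distance l = e (c l) u

record Centres (n k z : ℕ) : Set where
  field
    outlierSet   : Subset n
    centreOf     : Fin k → Fin n
    withinBudget : ∣ outlierSet ∣ ℕ.≤ z
    injective    : Injective _≡_ _≡_ centreOf
    notOutlier   : ∀ l → centreOf l ∉ outlierSet

open Centres public

centresOf : {n k z : ℕ} {d : Dist n} → Solution d k z → Centres n k z
centresOf s = record
  { outlierSet = outliers s ; centreOf = center s ; withinBudget = budget s
  ; injective = distinct s ; notOutlier = centerOk s }

solveWith : {n k z : ℕ} (e : Dist n) (C : Centres n k z) →
            (∀ u → NearestCentre e (centreOf C) u) → Solution e k z
solveWith e C near = record
  { outliers = outlierSet C ; center = centreOf C ; assign = λ u → proj₁ (near u)
  ; budget = withinBudget C ; distinct = injective C ; centerOk = notOutlier C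
  ; voronoi = λ u _ → proj₂ (near u) }

Covers : {n k z : ℕ} → Dist n → Centres n k z → ℚ → Set
Covers {n} {k} e C R = ∀ u → u ∉ outlierSet C → Σ (Fin k) λ l → e (centreOf C l) u ≤ R

solveWith-cost≤ : {n k z : ℕ} (e : Dist n) (C : Centres n k z)
                  (near : ∀ u → NearestCentre e (centreOf C) u) {R : ℚ} →
                  0ℚ ≤ R → Covers e C R → cost e (solveWith e C near) ≤ R
solveWith-cost≤ e C near 0≤R covers = cost≤ e (solveWith e C near) 0≤R λ u u∉Z →
  let (l , within) = covers u u∉Z in ≤-trans (proj₂ (near u) l) within

replace : {n k : ℕ} → (Fin k → Fin n) → Fin k → Fin n → Fin k → Fin n
replace c i x = updateAt c i (const x)

replace-at : {n k : ℕ} (c : Fin k → Fin n) (i : Fin k) (x : Fin n) → replace c i x i ≡ x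
replace-at c i x = updateAt-updates i c

replace-elsewhere : {n k : ℕ} (c : Fin k → Fin n) {i l : Fin k} (x : Fin n) →
                    l ≢ i → replace c i x l ≡ c l
replace-elsewhere c {i} {l} x l≢i = updateAt-minimal l i c l≢i

replace-preserves : {n k : ℕ} (P : Fin n → Set) {c : Fin k → Fin n} {i : Fin k} {x : Fin n} →
                    P x → (∀ l → P (c l)) → ∀ l → P (replace c i x l)
replace-preserves P {c} {i} {x} Px Pc l with l ≟ i
... | yes refl = subst P (sym (replace-at c i x)) Px
... | no l≢i   = subst P (sym (replace-elsewhere c x l≢i)) (Pc l)

replace-injective : {n k : ℕ} {c : Fin k → Fin n} {i : Fin k} {x : Fin n} →
                    Injective _≡_ _≡_ c → (∀ l → l ≢ i → c l ≢ x) →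
                    Injective _≡_ _≡_ (replace c i x)
replace-injective {c = c} {i} {x} c-inj fresh {l₁} {l₂} same with l₁ ≟ i | l₂ ≟ i
... | yes refl | yes refl = refl
... | yes refl | no l₂≢i  = ⊥-elim (fresh l₂ l₂≢i
        (trans (sym (replace-elsewhere c x l₂≢i)) (trans (sym same) (replace-at c i x))))
... | no l₁≢i  | yes refl = ⊥-elim (fresh l₁ l₁≢i
        (trans (sym (replace-elsewhere c x l₁≢i)) (trans same (replace-at c i x))))
... | no l₁≢i  | no l₂≢i  = c-inj
        (trans (sym (replace-elsewhere c x l₁≢i)) (trans same (replace-elsewhere c x l₂≢i)))

½*-nonneg : ∀ {x} → 0ℚ ≤ x → 0ℚ ≤ ½ * x
½*-nonneg x≥0 = *-monoˡ-≤-nonNeg ½ x≥0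

≤-+-nonneg : ∀ {x y} → 0ℚ ≤ y → x ≤ x + y
≤-+-nonneg {x} y≥0 = ≤-trans (≤-reflexive (sym (+-identityʳ x))) (+-monoʳ-≤ x y≥0)

½*-double : ∀ x → ½ * x + ½ * x ≡ x
½*-double x = trans (sym (*-distribʳ-+ x ½ ½)) (*-identityˡ x)

½*≤ : ∀ {x} → 0ℚ ≤ x → ½ * x ≤ x
½*≤ {x} x≥0 = ≤-trans (≤-+-nonneg (½*-nonneg x≥0)) (≤-reflexive (½*-double x))

½*-of-double : ∀ r → ½ * (r + r) ≡ r
½*-of-double r = trans (*-distribˡ-+ ½ r r) (½*-double r)

module Shrink (r : ℚ) (r≥0 : 0ℚ ≤ r) where

  shrink : ℚ → ℚ
  shrink x = x ⊓ (r ⊔ ½ * x)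

  shrink≤ : ∀ x → shrink x ≤ x
  shrink≤ x = p⊓q≤p x _

  ½*≤shrink : ∀ {x} → 0ℚ ≤ x → ½ * x ≤ shrink x
  ½*≤shrink x≥0 = ⊓-glb (½*≤ x≥0) (p≤q⊔p r _)

  shrink-nonneg : ∀ {x} → 0ℚ ≤ x → 0ℚ ≤ shrink x
  shrink-nonneg x≥0 = ≤-trans (½*-nonneg x≥0) (½*≤shrink x≥0)

  shrink-mono : ∀ {x y} → x ≤ y → shrink x ≤ shrink y
  shrink-mono {x} {y} x≤y = ⊓-mono-≤ x≤y (⊔-monoʳ-≤ r (*-monoˡ-≤-nonNeg ½ x≤y))

  shrink-fixes : ∀ {x} → x ≤ r → shrink x ≡ x
  shrink-fixes x≤r = p≤q⇒p⊓q≡p (≤-trans x≤r (p≤p⊔q r _))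

  shrink≤r : ∀ {x} → x ≤ r + r → shrink x ≤ r
  shrink≤r {x} x≤2r = ≤-trans (p⊓q≤q x _)
    (⊔-lub ≤-refl (≤-trans (*-monoˡ-≤-nonNeg ½ x≤2r) (≤-reflexive (½*-of-double r))))

  shrink<r⇒fixed : ∀ {x} → shrink x < r → shrink x ≡ x
  shrink<r⇒fixed {x} shrunk<r with ⊓-sel x (r ⊔ ½ * x)
  ... | inj₁ fixed  = fixed
  ... | inj₂ capped = ⊥-elim (<-irrefl refl
          (<-≤-trans shrunk<r (≤-trans (p≤p⊔q r (½ * x)) (≤-reflexive (sym capped)))))

  shrink-zero : ∀ {x} → 0ℚ ≤ x → shrink x ≡ 0ℚ → x ≡ 0ℚ
  shrink-zero x≥0 shrunk≡0 =
    ≤-antisym (*-cancelˡ-≤-pos ½ (≤-trans (½*≤shrink x≥0) (≤-reflexive shrunk≡0))) x≥0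

  capped-subadditive : ∀ {x y} → 0ℚ ≤ y → shrink x ≡ r ⊔ ½ * x →
                       shrink (x + y) ≤ shrink x + shrink y
  capped-subadditive {x} {y} y≥0 capped = begin
    shrink (x + y)          ≤⟨ p⊓q≤q (x + y) _ ⟩
    r ⊔ ½ * (x + y)         ≤⟨ ⊔-lub (≤-trans (p≤p⊔q r (½ * x)) (≤-+-nonneg (½*-nonneg y≥0)))
                                      (≤-trans (≤-reflexive (*-distribˡ-+ ½ x y))
                                               (+-monoˡ-≤ (½ * y) (p≤q⊔p r (½ * x)))) ⟩
    (r ⊔ ½ * x) + ½ * y     ≤⟨ +-mono-≤ (≤-reflexive (sym capped)) (½*≤shrink y≥0) ⟩
    shrink x + shrink y     ∎
    where open ≤-Reasoning

  shrink-subadditive : ∀ {x y} → 0ℚ ≤ x → 0ℚ ≤ y → shrink (x + y) ≤ shrink x + shrink y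
  shrink-subadditive {x} {y} x≥0 y≥0 with ⊓-sel x (r ⊔ ½ * x) | ⊓-sel y (r ⊔ ½ * y)
  ... | inj₂ x-capped | _ = capped-subadditive {x} y≥0 x-capped
  ... | inj₁ _ | inj₂ y-capped = begin
    shrink (x + y)          ≡⟨ cong shrink (+-comm x y) ⟩
    shrink (y + x)          ≤⟨ capped-subadditive {y} x≥0 y-capped ⟩
    shrink y + shrink x     ≡⟨ +-comm (shrink y) (shrink x) ⟩
    shrink x + shrink y     ∎
    where open ≤-Reasoning
  ... | inj₁ x-fixed | inj₁ y-fixed = begin
    shrink (x + y)          ≤⟨ shrink≤ (x + y) ⟩
    x + y                   ≡⟨ sym (cong₂ _+_ x-fixed y-fixed) ⟩
    shrink x + shrink y     ∎
    where open ≤-Reasoning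

  shrinkDist : {n : ℕ} → Dist n → Dist n
  shrinkDist d u v = shrink (d u v)

  shrink-isMetric : {n : ℕ} {d : Dist n} → IsMetric d → IsMetric (shrinkDist d)
  shrink-isMetric {d = d} dm = record
    { nonneg   = λ u v → shrink-nonneg (nonneg u v)
    ; zero-iff = λ u v shrunk≡0 → zero-iff u v (shrink-zero (nonneg u v) shrunk≡0)
    ; refl0    = λ u → trans (cong shrink (refl0 u)) (shrink-fixes r≥0)
    ; symm     = λ u v → cong shrink (symm u v)
    ; triangle = λ u v w → ≤-trans (shrink-mono (triangle u v w))
                                   (shrink-subadditive (nonneg u v) (nonneg v w))
    }
    where open IsMetric dm

  shrink-isPerturbation : {n : ℕ} {d : Dist n} → IsMetric d → IsPerturbation2 d (shrinkDist d)
  shrink-isPerturbation {d = d} dm u v = ½*≤shrink (IsMetric.nonneg dm u v) , shrink≤ (d u v)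

module Optimality {n k z : ℕ} {d : Dist n} (s : Solution d k z) (opt : Optimal d k z s) where

  r : ℚ
  r = cost d s

  r≥0 : 0ℚ ≤ r
  r≥0 = cost-nonneg d s

  open Shrink r r≥0 public

  D : Dist n
  D = shrinkDist d

  -- A D-solution cheaper than r used only unshrunk distances, so re-assigning
  -- its points to d-nearest centres gives a d-solution cheaper than r.
  r≤cost : (S : Solution D k z) → r ≤ cost D S
  r≤cost S = ≮⇒≥ cheaper-impossible
    where
    near : ∀ u → NearestCentre d (center S) u
    near u = nearestCentre d (center S) (assign S u) u
    reassigned : Solution d k z
    reassigned = solveWith d (centresOf S) near
    unshrunk : cost D S < r → ∀ u → u ∉ outliers S → d (center S (assign S u)) u ≤ cost D S
    unshrunk cheap u u∉Z = ≤-trans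
      (≤-reflexive (sym (shrink<r⇒fixed (≤-<-trans (assigned≤cost D S u u∉Z) cheap))))
      (assigned≤cost D S u u∉Z)
    cheaper-impossible : cost D S < r → ⊥
    cheaper-impossible cheap = <-irrefl refl (≤-<-trans (≤-trans (opt reassigned) reassigned≤) cheap)
      where
      reassigned≤ : cost d reassigned ≤ cost D S
      reassigned≤ = solveWith-cost≤ d (centresOf S) near (cost-nonneg D S)
                      λ u u∉Z → assign S u , unshrunk cheap u u∉Z

  cheap⇒optimal : (S : Solution D k z) → cost D S ≤ r → Optimal D k z S
  cheap⇒optimal S cheap S' = ≤-trans cheap (r≤cost S')

module Resilience {n k z : ℕ} {d : Dist n} (dm : IsMetric d) (pr : PerturbationResilient2 d k z)
                  (s : Solution d k z) (opt : Optimal d k z s) where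

  open Optimality s opt
  open IsMetric dm

  Z : Subset n
  Z = outliers s
  c : Fin k → Fin n
  c = center s
  σ : Fin n → Fin k
  σ = assign s

  flip≤ : ∀ {u v R} → d u v ≤ R → d v u ≤ R
  flip≤ {u} {v} uv≤R = ≤-trans (≤-reflexive (symm v u)) uv≤R

  D-isMetric : IsMetric D
  D-isMetric = shrink-isMetric dm

  sameAs : (S : Solution D k z) → cost D S ≤ r → SameClusteringAndOutliers s S
  sameAs S cheap = pr D D-isMetric (shrink-isPerturbation dm) s opt S (cheap⇒optimal S cheap)

  near-own-centre : ∀ u → u ∉ Z → d (c (σ u)) u ≤ r
  near-own-centre = assigned≤cost d s

  -- Points of one cluster are within 2r of each other, hence within r under D.
  same-cluster-D≤r : ∀ {u v} → u ∉ Z → v ∉ Z → σ u ≡ σ v → D u v ≤ r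
  same-cluster-D≤r {u} {v} u∉Z v∉Z σu≡σv = shrink≤r (≤-trans (triangle u (c (σ u)) v)
    (+-mono-≤ (flip≤ (near-own-centre u u∉Z))
              (subst (λ l → d (c l) v ≤ r) (sym σu≡σv) (near-own-centre v v∉Z))))

  D≤d≤r : ∀ {u} → u ∉ Z → D (c (σ u)) u ≤ r
  D≤d≤r {u} u∉Z = ≤-trans (shrink≤ _) (near-own-centre u u∉Z)

  -- An outlier q within r of a non-outlier p could be served, under D, by the
  -- centre of p; dropping q from the outliers then gives a D-optimal solution
  -- whose outliers differ from Z, contradicting resilience.
  outlier-within-r-impossible : ∀ {p q} → p ∉ Z → q ∈ Z → d p q ≤ r → ⊥
  outlier-within-r-impossible {p} {q} p∉Z q∈Z pq≤r =
    ℕ.<-irrefl (cong ∣_∣ (sym Z≡Z-q)) (x∈p⇒∣p-x∣<∣p∣ q∈Z)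
    where
    fewer : Centres n k z
    fewer = record (centresOf s)
      { outlierSet   = Z - q
      ; withinBudget = ℕ.≤-trans (∣p─q∣≤∣p∣ Z _) (budget s)
      ; notOutlier   = λ l c∈ → centerOk s l (p─q⊆p Z _ c∈) }
    covers : Covers D fewer r
    covers u u∉Z-q with u ≟ q
    ... | yes refl = σ p , shrink≤r (≤-trans (triangle (c (σ p)) p q) (+-mono-≤ (near-own-centre p p∉Z) pq≤r))
    ... | no  u≢q  = σ u , D≤d≤r (λ u∈Z → u∉Z-q (x∈p∧x≢y⇒x∈p-y u∈Z u≢q))
    near : ∀ u → NearestCentre D c u
    near = nearestCentre D c (σ p)
    Z≡Z-q : Z ≡ Z - q
    Z≡Z-q = proj₁ (sameAs (solveWith D fewer near) (solveWith-cost≤ D fewer near r≥0 covers))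

  σ∘c : ∀ l → σ (c l) ≡ l
  σ∘c = own-centre dm s

  CrossPair : Fin n × Fin n → Set
  CrossPair (u , v) = u ∉ Z × v ∉ Z × σ u ≢ σ v

  crossPair? : Decidable CrossPair
  crossPair? (u , v) = ¬? (u ∈? Z) ×-dec (¬? (v ∈? Z) ×-dec ¬? (σ u ≟ σ v))

  record ClosestCrossPair (p q : Fin n) : Set where
    field
      p∉Z     : p ∉ Z
      q∉Z     : q ∉ Z
      apart   : σ p ≢ σ q
      closest : ∀ u v → u ∉ Z → v ∉ Z → σ u ≢ σ v → d p q ≤ d u v

  swap : ∀ {p q} → ClosestCrossPair p q → ClosestCrossPair q p
  swap {p} {q} P = record
    { p∉Z = q∉Z ; q∉Z = p∉Z ; apart = apart ∘ sym
    ; closest = λ u v u∉Z v∉Z σu≢σv → flip≤ (closest u v u∉Z v∉Z σu≢σv) }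
    where open ClosestCrossPair P

  closestCrossPair : ∀ {p q} → CrossPair (p , q) →
                     Σ (Fin n × Fin n) λ (p' , q') → ClosestCrossPair p' q' × d p' q' ≤ d p q
  closestCrossPair {p} {q} pq-cross =
    best , record { p∉Z = p'∉Z ; q∉Z = q'∉Z ; apart = apart ; closest = closest } ,
    f[argmin]≤f[⊤] {f = distance} (p , q) candidates
    where
    distance : Fin n × Fin n → ℚ
    distance (u , v) = d u v
    candidates : List (Fin n × Fin n)
    candidates = filter crossPair? (cartesianProduct (allFin n) (allFin n))
    best : Fin n × Fin n
    best = argmin distance (p , q) candidates
    best-cross : CrossPair best
    best-cross = argmin-all distance pq-cross (all-filter crossPair? (cartesianProduct (allFin n) (allFin n)))
    p'∉Z : proj₁ best ∉ Z
    p'∉Z = proj₁ best-cross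
    q'∉Z : proj₂ best ∉ Z
    q'∉Z = proj₁ (proj₂ best-cross)
    apart : σ (proj₁ best) ≢ σ (proj₂ best)
    apart = proj₂ (proj₂ best-cross)
    closest : ∀ u v → u ∉ Z → v ∉ Z → σ u ≢ σ v → distance best ≤ d u v
    closest u v u∉Z v∉Z σu≢σv = All.lookup (f[argmin]≤f[xs] {f = distance} (p , q) candidates)
      (∈-filter⁺ crossPair? (∈-cartesianProduct⁺ (∈-allFin u) (∈-allFin v)) (u∉Z , v∉Z , σu≢σv))

  -- A point w that can become the centre of q's cluster once p becomes the
  -- centre of its own cluster and q is moved to p's cluster.
  record Substitute (p q w : Fin n) : Set where
    field
      w∉Z       : w ∉ Z
      w≢p       : w ≢ p
      notCentre : ∀ l → l ≢ σ p → l ≢ σ q → c l ≢ w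
      far       : d p q ≤ d w q
      covers    : ∀ v → v ∉ Z → σ v ≡ σ q → D p v ≤ r ⊎ D w v ≤ r

  -- Recentring at p and w (other centres unchanged) and assigning q to p gives
  -- a D-solution of cost ≤ r in which p and q share a cluster, contradicting
  -- resilience.
  recentre : ∀ {p q w} → ClosestCrossPair p q → d p q ≤ r → Substitute p q w → ⊥
  recentre {p} {q} {w} P pq≤r W =
    apart (Equivalence.from (proj₂ same p q p∉Z q∉Z) (trans p↦i (sym q↦i)))
    where
    open ClosestCrossPair P
    open Substitute W
    i j : Fin k
    i = σ p
    j = σ q
    centreᵢ : Fin k → Fin n
    centreᵢ = replace c i p
    T : Fin k → Fin n
    T = replace centreᵢ j w
    T-i : T i ≡ p
    T-i = trans (replace-elsewhere centreᵢ w apart) (replace-at c i p)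
    T-j : T j ≡ w
    T-j = replace-at centreᵢ j w
    T-other : ∀ {l} → l ≢ i → l ≢ j → T l ≡ c l
    T-other l≢i l≢j = trans (replace-elsewhere centreᵢ w l≢j) (replace-elsewhere c p l≢i)
    p-fresh : ∀ l → l ≢ i → c l ≢ p
    p-fresh l l≢i cl≡p = l≢i (trans (sym (σ∘c l)) (cong σ cl≡p))
    w-fresh : ∀ l → l ≢ j → centreᵢ l ≢ w
    w-fresh l l≢j with l ≟ i
    ... | yes refl = λ p≡w → w≢p (trans (sym p≡w) (replace-at c i p))
    ... | no  l≢i  = λ cl≡w → notCentre l l≢i l≢j (trans (sym (replace-elsewhere c p l≢i)) cl≡w)
    recentred : Centres n k z
    recentred = record
      { outlierSet = Z ; centreOf = T ; withinBudget = budget s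
      ; injective  = replace-injective (replace-injective (distinct s) p-fresh) w-fresh
      ; notOutlier = replace-preserves (_∉ Z) w∉Z (replace-preserves (_∉ Z) p∉Z (centerOk s)) }
    -- The other centres are w or lie outside q's cluster, so they are no
    -- closer to q than p is.
    p-nearest-q : ∀ l → D p q ≤ D (T l) q
    p-nearest-q l with l ≟ i
    ... | yes refl = ≤-reflexive (cong (λ t → D t q) (sym T-i))
    ... | no  l≢i with l ≟ j
    ...   | yes refl = subst (λ t → D p q ≤ D t q) (sym T-j) (shrink-mono far)
    ...   | no  l≢j  = subst (λ t → D p q ≤ D t q) (sym (T-other l≢i l≢j))
              (shrink-mono (closest (c l) q (centerOk s l) q∉Z (λ σcl≡j → l≢j (trans (sym (σ∘c l)) σcl≡j))))
    near : ∀ u → NearestCentre D T u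
    near u with u ≟ q
    ... | yes refl = i , subst (λ t → ∀ l → D t q ≤ D (T l) q) (sym T-i) p-nearest-q
    ... | no  _    = nearestCentre D T (σ u) u
    covering : Covers D recentred r
    covering u u∉Z with σ u ≟ i
    ... | yes σu≡i = i , subst (λ t → D t u ≤ r) (sym T-i) (same-cluster-D≤r p∉Z u∉Z (sym σu≡i))
    ... | no  σu≢i with σ u ≟ j
    ...   | yes σu≡j with covers u u∉Z σu≡j
    ...     | inj₁ Dpu≤r = i , subst (λ t → D t u ≤ r) (sym T-i) Dpu≤r
    ...     | inj₂ Dwu≤r = j , subst (λ t → D t u ≤ r) (sym T-j) Dwu≤r
    covering u u∉Z | no σu≢i | no σu≢j =
      σ u , subst (λ t → D t u ≤ r) (sym (T-other σu≢i σu≢j)) (D≤d≤r u∉Z)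
    S : Solution D k z
    S = solveWith D recentred near
    same : SameClusteringAndOutliers s S
    same = sameAs S (solveWith-cost≤ D recentred near r≥0 covering)
    p↦i : assign S p ≡ i
    p↦i = subst (λ t → assign S t ≡ i) T-i (own-centre D-isMetric S i)
    q↦i : assign S q ≡ i
    q↦i with q ≟ q
    ... | yes refl = refl
    ... | no  q≢q  = ⊥-elim (q≢q refl)

  substitute-in-cluster : ∀ {p q x} → ClosestCrossPair p q →
                          x ∉ Z → σ x ≡ σ q → d p q ≤ d x q → Substitute p q x
  substitute-in-cluster P x∉Z σx≡σq far = record
    { w∉Z       = x∉Z
    ; w≢p       = λ x≡p → apart (trans (cong σ (sym x≡p)) σx≡σq)
    ; notCentre = λ l _ l≢σq cl≡x → l≢σq (trans (sym (σ∘c l)) (trans (cong σ cl≡x) σx≡σq))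
    ; far       = far
    ; covers    = λ v v∉Z σv≡σq → inj₂ (same-cluster-D≤r x∉Z v∉Z (trans σx≡σq (sym σv≡σq)))
    }
    where open ClosestCrossPair P

  -- q's whole cluster lies within d(p,q) of q (so p covers it under D).
  ClusterNear : Fin n → Fin n → Set
  ClusterNear p q = ∀ x → x ∉ Z → σ x ≡ σ q → d x q ≤ d p q

  clusterFar-or-near : ∀ p q →
    (Σ (Fin n) λ x → x ∉ Z × σ x ≡ σ q × d p q ≤ d x q) ⊎ ClusterNear p q
  clusterFar-or-near p q with any? (λ x → ¬? (x ∈? Z) ×-dec ((σ x ≟ σ q) ×-dec (d p q ≤? d x q)))
  ... | yes far = inj₁ far
  ... | no none = inj₂ λ x x∉Z σx≡σq → <⇒≤ (≰⇒> λ far → none (x , x∉Z , σx≡σq , far))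

  substitute-elsewhere : ∀ {p q w} → ClosestCrossPair p q → d p q ≤ r → ClusterNear p q →
                         w ∉ Z → w ≢ p → σ w ≢ σ q → (∀ l → c l ≡ w → l ≡ σ p) →
                         Substitute p q w
  substitute-elsewhere {p} {q} {w} P pq≤r clusterNear w∉Z w≢p σw≢σq centreOnlyOf = record
    { w∉Z       = w∉Z
    ; w≢p       = w≢p
    ; notCentre = λ l l≢σp _ cl≡w → l≢σp (centreOnlyOf l cl≡w)
    ; far       = closest w q w∉Z q∉Z σw≢σq
    ; covers    = λ v v∉Z σv≡σq → inj₁ (shrink≤r (≤-trans (triangle p q v)
                    (+-mono-≤ pq≤r (flip≤ (≤-trans (clusterNear v v∉Z σv≡σq) pq≤r)))))
    }
    where open ClosestCrossPair P

  -- A non-outlier u outside q's cluster that is no centre gives a substitute: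
  -- u itself, or the centre of p's cluster when u = p.
  recentre-via-nonCentre : ∀ {p q u} → ClosestCrossPair p q → d p q ≤ r → ClusterNear p q →
                           u ∉ Z → σ u ≢ σ q → (∀ l → c l ≢ u) → ⊥
  recentre-via-nonCentre {p} {q} {u} P pq≤r clusterNear u∉Z σu≢σq noCentre with u ≟ p
  ... | yes refl = recentre P pq≤r (substitute-elsewhere P pq≤r clusterNear
        (centerOk s (σ p)) (noCentre (σ p)) (λ σcσp≡σq → σu≢σq (trans (sym (σ∘c (σ p))) σcσp≡σq))
        (λ l cl≡cσp → distinct s cl≡cσp))
  ... | no  u≢p  = recentre P pq≤r (substitute-elsewhere P pq≤r clusterNear
        u∉Z u≢p σu≢σq (λ l cl≡u → ⊥-elim (noCentre l cl≡u)))

  nonCentre-or-zero : (Σ (Fin n) λ u → u ∉ Z × (∀ l → c l ≢ u)) ⊎ r ≤ 0ℚ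
  nonCentre-or-zero with any? (λ u → ¬? (u ∈? Z) ×-dec (0ℚ <? d (c (σ u)) u))
  ... | yes (u , u∉Z , positive) = inj₁ (u , u∉Z , λ l cl≡u →
          <-irrefl (sym (subst (λ t → d (c (σ t)) t ≡ 0ℚ) cl≡u (centre-at-zero l))) positive)
    where
    centre-at-zero : ∀ l → d (c (σ (c l))) (c l) ≡ 0ℚ
    centre-at-zero l = trans (cong (λ m → d (c m) (c l)) (σ∘c l)) (refl0 (c l))
  ... | no none = inj₂ (cost≤ d s ≤-refl λ u u∉Z → ≮⇒≥ λ positive → none (u , u∉Z , positive))

  closest-pair-within-r-impossible : ∀ {p q} → ClosestCrossPair p q → d p q ≤ r → ⊥
  closest-pair-within-r-impossible {p} {q} P pq≤r
    with clusterFar-or-near p q | clusterFar-or-near q p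
  ... | inj₁ (x , x∉Z , σx≡σq , far) | _ =
        recentre P pq≤r (substitute-in-cluster P x∉Z σx≡σq far)
  ... | inj₂ _ | inj₁ (y , y∉Z , σy≡σp , far) =
        recentre (swap P) (flip≤ pq≤r) (substitute-in-cluster (swap P) y∉Z σy≡σp far)
  ... | inj₂ q-near | inj₂ p-near with nonCentre-or-zero
  ...   | inj₂ r≤0 = ClosestCrossPair.apart P
          (cong σ (zero-iff p q (≤-antisym (≤-trans pq≤r r≤0) (nonneg p q))))
  ...   | inj₁ (u , u∉Z , noCentre) with σ u ≟ σ q
  ...     | no  σu≢σq = recentre-via-nonCentre P pq≤r q-near u∉Z σu≢σq noCentre
  ...     | yes σu≡σq = recentre-via-nonCentre (swap P) (flip≤ pq≤r) p-near u∉Z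
                          (λ σu≡σp → ClosestCrossPair.apart P (trans (sym σu≡σp) σu≡σq)) noCentre

  separated-within-r-impossible : ∀ {p q} → p ∉ Z → q ∉ Z → σ p ≢ σ q → d p q ≤ r → ⊥
  separated-within-r-impossible p∉Z q∉Z apart pq≤r with closestCrossPair (p∉Z , q∉Z , apart)
  ... | _ , P , closer = closest-pair-within-r-impossible P (≤-trans closer pq≤r)

mainTheorem5 : ∀ (n k z : ℕ) (d : Dist n) → IsMetric d →
    PerturbationResilient2 d k z →
    ∀ (s : Solution d k z) → Optimal d k z s →
    ∀ (p q : Fin n) → p ∉ Solution.outliers s →
    (q ∈ Solution.outliers s ⊎
      (q ∉ Solution.outliers s × Solution.assign s q ≢ Solution.assign s p)) →
    cost d s < d p q
mainTheorem5 n k z d dm pr s opt p q p∉Z (inj₁ q∈Z) =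
  ≰⇒> (outlier-within-r-impossible p∉Z q∈Z)
  where open Resilience dm pr s opt
mainTheorem5 n k z d dm pr s opt p q p∉Z (inj₂ (q∉Z , σq≢σp)) =
  ≰⇒> (separated-within-r-impossible p∉Z q∉Z (σq≢σp ∘ sym))
  where open Resilience dm pr s opt
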